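{- Let $P$ and $Q$ be syntactic protocols such that $P$ is a strengthening of $Q$. Then for every agent $a$ and every formula $\phi$, the formulas $K_a^Q\phi\rightarrow K_a^P\phi$ and $\hat K_a^P\phi\rightarrow\hat K_a^Q\phi$ are valid.
   Context: Let $A$ be a finite set of agents. A gossip graph is $G=(A,N,S)$ with $N,S\subseteq A\times A$, $I\subseteq S\subseteq N$; $N_ab$: $a$ knows $b$'s number; $S_ab$: $a$ knows $b$'s secret; $G$ is initial if $S=I$. A call $ab$ ($a\neq b$) is possible iff $N_ab$; executing it gives both $a$ and $b$ the union of their numbers and of their secrets (others unchanged); $G^\sigma=(A,N^\sigma,S^\sigma)$ is the result of executing call sequence $\sigma$. A gossip state is $(G,\sigma)$ with $G$ initial and $\sigma$ a sequence of calls each possible when made. Formulas $\phi::=\top\mid N_ab\mid S_ab\mid\neg\phi\mid\phi\wedge\phi\mid K_a^P\phi\mid[\pi]\phi$, programs $\pi::=?\phi\mid ab\mid\pi;\pi\mid\pi\cup\pi\mid\pi^*$; $\hat K_a^P\phi:=\neg K_a^P\neg\phi$. A syntactic protocol $P$ is given by protocol conditions $P_{ab}$ (formulas, $a\neq b$); $ab$ is $P$-permitted at $(G,\sigma)$ iff $G,\sigma\models N_ab\wedge P_{ab}$; $P(G)$ is the set of call sequences built from $\epsilon$ by appending $P$-permitted calls. Epistemic relation $\sim_a^P$: (1) $(G,\epsilon)\sim_a^P(G,\epsilon)$; (2) if $(G,\sigma)\sim_a^P(G,\tau)$, $N^\sigma_b=N^\tau_b$, $S^\sigma_b=S^\tau_b$,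 and $ab$ is $P$-permitted at both, then $(G,\sigma;ab)\sim_a^P(G,\tau;ab)$, likewise for $ba$; (3) if $(G,\sigma)\sim_a^P(G,\tau)$, $c,d,e,f\neq a$, $cd$ $P$-permitted at $(G,\sigma)$ and $ef$ at $(G,\tau)$, then $(G,\sigma;cd)\sim_a^P(G,\tau;ef)$. Semantics: $K_a^P\phi$ true at $(G,\sigma)$ iff $\phi$ true at all $(G,\sigma')$ with $(G,\sigma')\sim_a^P(G,\sigma)$; atoms via $N^\sigma,S^\sigma$; Booleans and $[\pi]$ standard (call $ab$ leads to $(G,\sigma;ab)$ when $N^\sigma_ab$). Valid means true at all gossip states. $P$ is a strengthening of $Q$ iff $P_{ab}\rightarrow Q_{ab}$ is valid for all $a\neq b$ (syntactic strengthening), or more generally $P(G)\subseteq Q(G)$ for all initial $G$ (semantic strengthening). -}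

module Defs where

open import Data.Nat using (ℕ)
open import Data.Fin using (Fin; _≟_)
open import Data.Bool using (Bool; true; false; _∨_; if_then_else_)
open import Data.Product using (_×_; _,_; ∃)
open import Data.Sum using (_⊎_)
open import Data.Empty using (⊥)
open import Data.Unit using () renaming (⊤ to Unit)
open import Relation.Nullary using (¬_)
open import Relation.Nullary.Decidable using (⌊_⌋)
open import Relation.Binary.PropositionalEquality using (_≡_; _≢_)
open import Relation.Binary.Construct.Closure.ReflexiveTransitive using (Star)

record Graph (n : ℕ) : Set where
  field
    N : Fin n → Fin n → Bool   -- N a b : a knows b's number
    S : Fin n → Fin n → Bool   -- S a b : a knows b's secret
open Graph public

-- An initial gossip graph: I ⊆ N and S = I.
record InitGraph (n : ℕ) : Set where
  field
    numbers : Fin n → Fin n → Bool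
    refl-N  : ∀ a → numbers a a ≡ true
open InitGraph public

toGraph : ∀ {n} → InitGraph n → Graph n
toGraph G = record { N = numbers G ; S = λ a b → ⌊ a ≟ b ⌋ }

Call : ℕ → Set
Call n = Fin n × Fin n

data Seq (n : ℕ) : Set where
  ε   : Seq n
  _▷_ : Seq n → Call n → Seq n

doCall : ∀ {n} → Graph n → Call n → Graph n
doCall G (a , b) = record
  { N = λ x y → if ⌊ x ≟ a ⌋ ∨ ⌊ x ≟ b ⌋ then N G a y ∨ N G b y else N G x y
  ; S = λ x y → if ⌊ x ≟ a ⌋ ∨ ⌊ x ≟ b ⌋ then S G a y ∨ S G b y else S G x y
  }

exec : ∀ {n} → Graph n → Seq n → Graph n
exec G ε       = G
exec G (σ ▷ c) = doCall (exec G σ) c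

Nσ : ∀ {n} → InitGraph n → Seq n → Fin n → Fin n → Bool
Nσ G σ = N (exec (toGraph G) σ)

Sσ : ∀ {n} → InitGraph n → Seq n → Fin n → Fin n → Bool
Sσ G σ = S (exec (toGraph G) σ)

data IsState {n} (G : InitGraph n) : Seq n → Set where
  st-ε : IsState G ε
  st-▷ : ∀ {σ a b} → IsState G σ → a ≢ b → Nσ G σ a b ≡ true →
         IsState G (σ ▷ (a , b))

-- Formulas and programs (protocols appear in K, as their conditions P_ab)

data Form (n : ℕ) : Set
data Prog (n : ℕ) : Set

data Form n where
  fTrue   : Form n
  fN   : Fin n → Fin n → Form n
  fS   : Fin n → Fin n → Form n
  fNot   : Form n → Form n
  _∧f_ : Form n → Form n → Form n
  fK   : Fin n → (Fin n → Fin n → Form n) → Form n → Form n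
  [_]_ : Prog n → Form n → Form n

data Prog n where
  fTest    : Form n → Prog n
  fCall : (a b : Fin n) → a ≢ b → Prog n
  _；_  : Prog n → Prog n → Prog n
  _∪p_  : Prog n → Prog n → Prog n
  _*p   : Prog n → Prog n

-- A syntactic protocol: its protocol conditions P_ab (values at a = b unused)
Protocol : ℕ → Set
Protocol n = Fin n → Fin n → Form n

_⇒f_ : ∀ {n} → Form n → Form n → Form n
φ ⇒f ψ = fNot (φ ∧f fNot ψ)

Kdual : ∀ {n} → Fin n → Protocol n → Form n → Form n
Kdual a P φ = fNot (fK a P (fNot φ))

data Indist {n} (G : InitGraph n) (perm : Seq n → Fin n → Fin n → Set)
            (a : Fin n) : Seq n → Seq n → Set where
  ind-ε   : Indist G perm a ε ε
  ind-ab  : ∀ {σ τ b} → Indist G perm a σ τ →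
            (∀ y → Nσ G σ b y ≡ Nσ G τ b y) →
            (∀ y → Sσ G σ b y ≡ Sσ G τ b y) →
            perm σ a b → perm τ a b →
            Indist G perm a (σ ▷ (a , b)) (τ ▷ (a , b))
  ind-ba  : ∀ {σ τ b} → Indist G perm a σ τ →
            (∀ y → Nσ G σ b y ≡ Nσ G τ b y) →
            (∀ y → Sσ G σ b y ≡ Sσ G τ b y) →
            perm σ b a → perm τ b a →
            Indist G perm a (σ ▷ (b , a)) (τ ▷ (b , a))
  ind-oth : ∀ {σ τ c d e f} → Indist G perm a σ τ →
            c ≢ a → d ≢ a → e ≢ a → f ≢ a →
            perm σ c d → perm τ e f →
            Indist G perm a (σ ▷ (c , d)) (τ ▷ (e , f))

Sat     : ∀ {n} → InitGraph n → Seq n → Form n → Set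
ProgRel : ∀ {n} → InitGraph n → Prog n → Seq n → Seq n → Set

Sat G σ fTrue         = Unit
Sat G σ (fN a b)   = Nσ G σ a b ≡ true
Sat G σ (fS a b)   = Sσ G σ a b ≡ true
Sat G σ (fNot φ)     = ¬ Sat G σ φ
Sat G σ (φ ∧f ψ)   = Sat G σ φ × Sat G σ ψ
Sat G σ (fK a P φ) =
  ∀ τ → Indist G (λ ρ c d → c ≢ d × Nσ G ρ c d ≡ true × Sat G ρ (P c d)) a τ σ
      → Sat G τ φ
Sat G σ ([ π ] φ)  = ∀ τ → ProgRel G π σ τ → Sat G τ φ

ProgRel G (fTest φ) σ τ       = σ ≡ τ × Sat G σ φ
ProgRel G (fCall a b _) σ τ = Nσ G σ a b ≡ true × τ ≡ σ ▷ (a , b)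
ProgRel G (π ； π') σ τ    = ∃ λ ρ → ProgRel G π σ ρ × ProgRel G π' ρ τ
ProgRel G (π ∪p π') σ τ    = ProgRel G π σ τ ⊎ ProgRel G π' σ τ
ProgRel G (π *p) σ τ       = Star (ProgRel G π) σ τ

Valid : ∀ {n} → Form n → Set
Valid {n} φ = (G : InitGraph n) (σ : Seq n) → IsState G σ → Sat G σ φ

Permitted : ∀ {n} → InitGraph n → Protocol n → Seq n → Fin n → Fin n → Set
Permitted G P σ c d = c ≢ d × Nσ G σ c d ≡ true × Sat G σ (P c d)

data InP {n} (G : InitGraph n) (P : Protocol n) : Seq n → Set where
  inP-ε : InP G P ε
  inP-▷ : ∀ {σ a b} → InP G P σ → Permitted G P σ a b → InP G P (σ ▷ (a , b))

SyntacticStrengthening : ∀ {n} → Protocol n → Protocol n → Set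
SyntacticStrengthening {n} P Q = (a b : Fin n) → a ≢ b → Valid (P a b ⇒f Q a b)

SemanticStrengthening : ∀ {n} → Protocol n → Protocol n → Set
SemanticStrengthening {n} P Q = (G : InitGraph n) (σ : Seq n) → InP G P σ → InP G Q σ

module Submission where

open import Defs
open import Data.Nat using (ℕ)
open import Data.Fin using (Fin)
open import Data.Product using (_×_; _,_; proj₁; proj₂)
open import Data.Sum using (_⊎_; inj₁; inj₂)
open import Data.Unit using (tt)
open import Data.Bool using () renaming (_≟_ to _≟ᵇ_)
open import Relation.Nullary using (¬_)
open import Relation.Nullary.Decidable using (decidable-stable)

-- A strengthening P of Q can only remove calls from P-runs, so two histories
-- a cannot tell apart under P are also indistinguishable under Q: the ~P-class
-- of a state is contained in its ~Q-class, and K^Q quantifies over more states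
-- than K^P.  The dual statement is the contrapositive for ¬φ.  Since P ⇒f Q is
-- encoded as ¬(P ∧ ¬Q), the syntactic case needs satisfaction to be ¬¬-stable,
-- which holds because the atoms are decidable.

Sat-¬¬-stable : ∀ {n} (G : InitGraph n) σ (φ : Form n) → ¬ ¬ Sat G σ φ → Sat G σ φ
Sat-¬¬-stable G σ fTrue      _   = tt
Sat-¬¬-stable G σ (fN a b)   ¬¬s = decidable-stable (Nσ G σ a b ≟ᵇ _) ¬¬s
Sat-¬¬-stable G σ (fS a b)   ¬¬s = decidable-stable (Sσ G σ a b ≟ᵇ _) ¬¬s
Sat-¬¬-stable G σ (fNot φ)   ¬¬s = λ s → ¬¬s (λ ¬s → ¬s s)
Sat-¬¬-stable G σ (φ ∧f ψ)   ¬¬s =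
  Sat-¬¬-stable G σ φ (λ ¬s → ¬¬s (λ s → ¬s (proj₁ s))) ,
  Sat-¬¬-stable G σ ψ (λ ¬s → ¬¬s (λ s → ¬s (proj₂ s)))
Sat-¬¬-stable G σ (fK a P φ) ¬¬s = λ τ i → Sat-¬¬-stable G τ φ (λ ¬s → ¬¬s (λ k → ¬s (k τ i)))
Sat-¬¬-stable G σ ([ π ] φ)  ¬¬s = λ τ r → Sat-¬¬-stable G τ φ (λ ¬s → ¬¬s (λ k → ¬s (k τ r)))

InP⇒IsState : ∀ {n} {G : InitGraph n} {P σ} → InP G P σ → IsState G σ
InP⇒IsState inP-ε                           = st-ε
InP⇒IsState (inP-▷ σ∈P (a≢b , Nab , _)) = st-▷ (InP⇒IsState σ∈P) a≢b Nab

PermittedOnRuns⇒ : ∀ {n} → InitGraph n → Protocol n → Protocol n → Set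
PermittedOnRuns⇒ G P Q =
  ∀ {ρ c d} → InP G P ρ → Permitted G P ρ c d → Permitted G Q ρ c d

syntactic⇒permittedOnRuns : ∀ {n} {P Q : Protocol n} → SyntacticStrengthening P Q →
                            (G : InitGraph n) → PermittedOnRuns⇒ G P Q
syntactic⇒permittedOnRuns {Q = Q} P⇒Q G {ρ} {c} {d} ρ∈P (c≢d , Ncd , Pcd) =
  c≢d , Ncd , Sat-¬¬-stable G ρ (Q c d) (λ ¬Qcd → P⇒Q c d c≢d G ρ (InP⇒IsState ρ∈P) (Pcd , ¬Qcd))

semantic⇒permittedOnRuns : ∀ {n} {P Q : Protocol n} → SemanticStrengthening P Q →
                           (G : InitGraph n) → PermittedOnRuns⇒ G P Q
semantic⇒permittedOnRuns P⊆Q G ρ∈P perm with P⊆Q G _ (inP-▷ ρ∈P perm)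
... | inP-▷ _ permQ = permQ

strengthening⇒permittedOnRuns : ∀ {n} {P Q : Protocol n} →
                                SyntacticStrengthening P Q ⊎ SemanticStrengthening P Q →
                                (G : InitGraph n) → PermittedOnRuns⇒ G P Q
strengthening⇒permittedOnRuns (inj₁ syn) = syntactic⇒permittedOnRuns syn
strengthening⇒permittedOnRuns (inj₂ sem) = semantic⇒permittedOnRuns sem

module _ {n} {G : InitGraph n} {P Q : Protocol n} {a : Fin n} where

  Indist⇒InP : ∀ {τ σ} → Indist G (Permitted G P) a τ σ → InP G P τ × InP G P σ
  Indist⇒InP ind-ε                   = inP-ε , inP-ε
  Indist⇒InP (ind-ab  i _ _ p q)     = inP-▷ (proj₁ (Indist⇒InP i)) p , inP-▷ (proj₂ (Indist⇒InP i)) q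
  Indist⇒InP (ind-ba  i _ _ p q)     = inP-▷ (proj₁ (Indist⇒InP i)) p , inP-▷ (proj₂ (Indist⇒InP i)) q
  Indist⇒InP (ind-oth i _ _ _ _ p q) = inP-▷ (proj₁ (Indist⇒InP i)) p , inP-▷ (proj₂ (Indist⇒InP i)) q

  Indist-mono : PermittedOnRuns⇒ G P Q → ∀ {τ σ} →
                Indist G (Permitted G P) a τ σ → Indist G (Permitted G Q) a τ σ
  Indist-mono P⇒Q ind-ε = ind-ε
  Indist-mono P⇒Q (ind-ab i N≡ S≡ p q) =
    ind-ab (Indist-mono P⇒Q i) N≡ S≡ (P⇒Q (proj₁ (Indist⇒InP i)) p) (P⇒Q (proj₂ (Indist⇒InP i)) q)
  Indist-mono P⇒Q (ind-ba i N≡ S≡ p q) =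
    ind-ba (Indist-mono P⇒Q i) N≡ S≡ (P⇒Q (proj₁ (Indist⇒InP i)) p) (P⇒Q (proj₂ (Indist⇒InP i)) q)
  Indist-mono P⇒Q (ind-oth i c≢a d≢a e≢a f≢a p q) =
    ind-oth (Indist-mono P⇒Q i) c≢a d≢a e≢a f≢a (P⇒Q (proj₁ (Indist⇒InP i)) p) (P⇒Q (proj₂ (Indist⇒InP i)) q)

  K-antitone : PermittedOnRuns⇒ G P Q → ∀ σ φ → Sat G σ (fK a Q φ) → Sat G σ (fK a P φ)
  K-antitone P⇒Q σ φ KQφ τ τ~σ = KQφ τ (Indist-mono P⇒Q τ~σ)

lemma22 : {n : ℕ} (P Q : Protocol n) →
          (SyntacticStrengthening P Q ⊎ SemanticStrengthening P Q) →
          (a : Fin n) (φ : Form n) →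
          Valid (fK a Q φ ⇒f fK a P φ) × Valid (Kdual a P φ ⇒f Kdual a Q φ)
lemma22 P Q strengthening a φ =
  (λ G σ _ (KQφ , ¬KPφ) → ¬KPφ (K-antitone (P⇒Q G) σ φ KQφ)) ,
  (λ G σ _ (¬KP¬φ , ¬¬KQ¬φ) → ¬¬KQ¬φ (λ KQ¬φ → ¬KP¬φ (K-antitone (P⇒Q G) σ (fNot φ) KQ¬φ)))
  where
  P⇒Q : ∀ G → PermittedOnRuns⇒ G P Q
  P⇒Q = strengthening⇒permittedOnRuns strengthening
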